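{- Let $r,n$ be positive integers and $p,p',q,q'$ positive divisors of $r$ with $pq=p'q'$ dividing $rn$. If $\mathrm{GCD}(p,n)=\mathrm{GCD}(p',n)$ and $\mathrm{GCD}(q,n)=\mathrm{GCD}(q',n)$, then $G(r,p,q,n)\cong G(r,p',q',n)$.
   Context: For a positive integer $r$ let $\zeta_r=\exp(2\pi\sqrt{ -1}/r)$ and $\mathbb{Z}_r=\mathbb{Z}/r\mathbb{Z}$. $G(r,n)$ is the group of $n\times n$ complex matrices with exactly one nonzero entry in each row and column, each nonzero entry an $r$th root of unity; its elements are written $(\pi,x)$ with $\pi\in S_n$, $x\in(\mathbb{Z}_r)^n$, meaning the matrix whose $i$th column has $\zeta_r^{x_i}$ in row $\pi(i)$. Put $\Delta(\pi,x)=\sum_i x_i$. For $p\mid r$, $G(r,p,n)=\{g\in G(r,n):\Delta(g)\in p\mathbb{Z}_r\}$. With $c=\zeta_rI_n$, when $p,q\mid r$ and $pq\mid rn$ the group $C_q=\langle c^{r/q}\rangle$ is central of order $q$ in $G(r,p,n)$ and $G(r,p,q,n):=G(r,p,n)/C_q$. -}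

module Defs where

open import Data.Nat using (ℕ; zero; suc)
open import Data.Nat.Divisibility using (_∣_; quotient)
open import Data.Integer as ℤ using (ℤ; +_)
import Data.Integer.Divisibility as ℤD
open import Data.Fin using (Fin) renaming (zero to fzero; suc to fsuc)
open import Data.Fin.Permutation using (Permutation′; _∘ₚ_; _⟨$⟩ʳ_)
open import Data.Product using (Σ; ∃; ∃₂; _×_; _,_)
open import Relation.Binary.PropositionalEquality using (_≡_)

-- An element (π , x) of G(r,n): π ∈ S_n, x : Fin n → ℤ (exponents, read mod r).
-- It denotes the matrix whose i-th column has ζ_r^(x i) in row π(i).
record GElem (n : ℕ) : Set where
  constructor ⟨_,_⟩
  field
    perm : Permutation′ n
    exps : Fin n → ℤ
open GElem public

-- Matrix product: (π,x)(σ,y) = (π∘σ , i ↦ x(σ i) + y i)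
-- (σ ∘ₚ π applies σ first, then π).
_·_ : ∀ {n} → GElem n → GElem n → GElem n
⟨ π , x ⟩ · ⟨ σ , y ⟩ = ⟨ σ ∘ₚ π , (λ i → x (σ ⟨$⟩ʳ i) ℤ.+ y i) ⟩

_≡[mod_]_ : ℤ → ℕ → ℤ → Set
a ≡[mod r ] b = (+ r) ℤD.∣ (a ℤ.- b)

sumℤ : ∀ n → (Fin n → ℤ) → ℤ
sumℤ zero    f = + 0
sumℤ (suc n) f = f fzero ℤ.+ sumℤ n (λ i → f (fsuc i))

Δ : ∀ {n} → GElem n → ℤ
Δ {n} g = sumℤ n (exps g)

InG : (r p : ℕ) → ∀ {n} → GElem n → Set
InG r p g = ∃ λ (k : ℤ) → Δ g ≡[mod r ] ((+ p) ℤ.* k)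

-- g and h define the same coset of C_q = ⟨ c^(r/q) ⟩ (c = ζ_r I_n), i.e.
-- h = g · c^(k·(r/q)) in G(r,n) for some integer k.  Here r/q = quotient qr.
SameCoset : (r q : ℕ) → q ∣ r → ∀ {n} → GElem n → GElem n → Set
SameCoset r q qr g h =
  (∀ i → perm g ⟨$⟩ʳ i ≡ perm h ⟨$⟩ʳ i) ×
  ∃ λ (k : ℤ) → ∀ i → exps h i ≡[mod r ] (exps g i ℤ.+ k ℤ.* (+ quotient qr))

-- A group isomorphism G(r,p,q,n) ≅ G(r,p',q',n), the quotients being
-- presented as subsets of G(r,n) modulo the coset relations.
record QuotIso (r n p q p' q' : ℕ) (qr : q ∣ r) (q'r : q' ∣ r) : Set where
  field
    f      : (g : GElem n) → InG r p g → GElem n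
    f-mem  : ∀ g (pg : InG r p g) → InG r p' (f g pg)
    f-cong : ∀ g h (pg : InG r p g) (ph : InG r p h) →
             SameCoset r q qr g h → SameCoset r q' q'r (f g pg) (f h ph)
    f-hom  : ∀ g h (pg : InG r p g) (ph : InG r p h) (pgh : InG r p (g · h)) →
             SameCoset r q' q'r (f (g · h) pgh) (f g pg · f h ph)
    f-inj  : ∀ g h (pg : InG r p g) (ph : InG r p h) →
             SameCoset r q' q'r (f g pg) (f h ph) → SameCoset r q qr g h
    f-surj : ∀ h → InG r p' h → ∃₂ λ g (pg : InG r p g) → SameCoset r q' q'r (f g pg) h

-- An element g of G(r,p,n) with Δ g = p k is sent to g c^(s k), where c = ζ_r I_n. Its Δ is
-- p k + n s k = p' M k, so it lies in G(r,p',n) provided p + s n = p' M; if moreover s q' = p σ,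
-- the choice of k (only defined up to multiples of r/p) and of the C_q-coset of g only move the
-- image inside its C_q'-coset, and the map is a homomorphism modulo C_q'. When M is a unit modulo
-- r, a map of the same shape with M replaced by an inverse of M inverts it.
--
-- Such s, M, σ exist under the gcd hypotheses. Write p = P d, p' = P' d with P, P' coprime, so
-- that q = P' Q and q' = P Q, and let g = gcd(d, n, Q) and n = B g. Comparing gcd(p, n) with
-- gcd(p', n), and gcd(q, n) with gcd(q', n), shows that P and P' are both prime to B. Then
-- P + τ B = P' M is solvable with M ≡ P P'⁻¹ (mod B) prime to r, and s = τ d/g, σ = τ Q/g.

module Submission where

open import Defs

open import Data.Nat as ℕ using (ℕ; zero; suc; _<_)
import Data.Nat.Properties as ℕ
open import Data.Nat.Divisibility using (_∣_; quotient; divides; divides-refl)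
import Data.Nat.Divisibility as ℕ
open import Data.Nat.GCD using (gcd; gcd[m,n]∣m; gcd[m,n]∣n; gcd-greatest; gcd-GCD; gcd[m,n]≢0; module GCD; module Bézout)
open import Data.Nat.Coprimality as Coprime using (Coprime; coprime-divisor; coprime-Bézout; Bézout-coprime; GCD≡1⇒coprime)
open import Data.Nat.Induction using (<-rec)
open import Data.Integer as ℤ using (ℤ; +_; _+_; _*_; _-_; -_; 0ℤ; 1ℤ)
import Data.Integer.Properties as ℤ
import Data.Integer.Divisibility.Signed as ℤ∣
open import Data.Integer.DivMod using (_%ℕ_; _/ℕ_; a≡a%ℕn+[a/ℕn]*n)
open import Data.Integer.Tactic.RingSolver using (solve; solve-∀)
import Data.Nat.Tactic.RingSolver as ℕ-Solver
open import Data.Fin using (Fin) renaming (zero to fzero; suc to fsuc)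
open import Data.Fin.Permutation using (Permutation′; _⟨$⟩ʳ_)
open import Data.List using ([]; _∷_)
open import Data.Product using (∃; ∃₂; _×_; _,_; proj₁; proj₂)
open import Data.Sum using (inj₁; inj₂)
open import Function using (_∘_)
open import Relation.Binary.Bundles using (Setoid)
open import Relation.Nullary using (contradiction)
open import Relation.Binary.PropositionalEquality
import Relation.Binary.Reasoning.Setoid as SetoidReasoning
open import Level using (0ℓ)
import Algebra.Properties.CommutativeMonoid.Sum as CommutativeMonoidSum
import Algebra.Properties.CommutativeSemigroup as CommutativeSemigroupProperties

open CommutativeSemigroupProperties ℤ.+-commutativeSemigroup using (interchange)

-- `_≡[mod_]_` unfolds to divisibility of an absolute value, from which unification cannot
-- recover the two sides; this wrapper keeps them as parameters.
infix 4 _≈[mod_]_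

record _≈[mod_]_ (a : ℤ) (r : ℕ) (b : ℤ) : Set where
  constructor mod-intro
  field mod-elim : a ≡[mod r ] b

open _≈[mod_]_ public

module _ {r : ℕ} where

  ≈[mod]⇒∃ : ∀ {a b} → a ≈[mod r ] b → ∃ λ t → a ≡ b + t * + r
  ≈[mod]⇒∃ {a} {b} (mod-intro r∣a-b) with ℤ∣.∣ᵤ⇒∣ {i = a - b} r∣a-b
  ... | ℤ∣.divides t a-b≡tr = t , (begin
    a             ≡⟨ solve (a ∷ b ∷ []) ⟩
    b + (a - b)   ≡⟨ cong (λ x → b + x) a-b≡tr ⟩
    b + t * + r   ∎)
    where open ≡-Reasoning

  +-multiple-≈[mod] : ∀ a t → a + t * + r ≈[mod r ] a
  +-multiple-≈[mod] a t = mod-intro (ℤ∣.∣⇒∣ᵤ (ℤ∣.divides t (x+y-x≡y a (t * + r))))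
    where
    x+y-x≡y : (x y : ℤ) → x + y - x ≡ y
    x+y-x≡y = solve-∀

  ≈[mod]-reflexive : ∀ {a b} → a ≡ b → a ≈[mod r ] b
  ≈[mod]-reflexive {a} refl = subst (_≈[mod r ] a) (ℤ.+-identityʳ a) (+-multiple-≈[mod] a 0ℤ)

  ≈[mod]-sym : ∀ {a b} → a ≈[mod r ] b → b ≈[mod r ] a
  ≈[mod]-sym {a} {b} (mod-intro a≡b) = mod-intro (subst (r ℕ.∣_) (ℤ.∣i-j∣≡∣j-i∣ a b) a≡b)

  ≈[mod]-trans : ∀ {a b c} → a ≈[mod r ] b → b ≈[mod r ] c → a ≈[mod r ] c
  ≈[mod]-trans {a} {b} {c} (mod-intro a≡b) (mod-intro b≡c) =
    mod-intro (ℤ∣.∣⇒∣ᵤ (subst (+ r ℤ∣.∣_) (ℤ.+-minus-telescope a b c)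
      (ℤ∣.∣m∣n⇒∣m+n (ℤ∣.∣ᵤ⇒∣ {i = a - b} a≡b) (ℤ∣.∣ᵤ⇒∣ {i = b - c} b≡c))))

  +-cong-≈[mod] : ∀ {a b c d} → a ≈[mod r ] b → c ≈[mod r ] d → a + c ≈[mod r ] b + d
  +-cong-≈[mod] {a} {b} {c} {d} (mod-intro a≡b) (mod-intro c≡d) =
    mod-intro (ℤ∣.∣⇒∣ᵤ (subst (+ r ℤ∣.∣_) rearrange
      (ℤ∣.∣m∣n⇒∣m+n (ℤ∣.∣ᵤ⇒∣ {i = a - b} a≡b) (ℤ∣.∣ᵤ⇒∣ {i = c - d} c≡d))))
    where
    rearrange : (a - b) + (c - d) ≡ (a + c) - (b + d)
    rearrange = solve (a ∷ b ∷ c ∷ d ∷ [])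

  +-congʳ-≈[mod] : ∀ {a b} c → a ≈[mod r ] b → a + c ≈[mod r ] b + c
  +-congʳ-≈[mod] c a≈b = +-cong-≈[mod] a≈b (≈[mod]-reflexive {a = c} refl)

≈[mod]-setoid : ℕ → Setoid 0ℓ 0ℓ
≈[mod]-setoid r = record
  { Carrier = ℤ
  ; _≈_ = _≈[mod r ]_
  ; isEquivalence = record { refl = ≈[mod]-reflexive refl ; sym = ≈[mod]-sym ; trans = ≈[mod]-trans }
  }

module ℤSum = CommutativeMonoidSum ℤ.+-0-commutativeMonoid

sumℤ≡sum : ∀ n (f : Fin n → ℤ) → sumℤ n f ≡ ℤSum.sum f
sumℤ≡sum zero    f = refl
sumℤ≡sum (suc n) f = cong (λ x → f fzero + x) (sumℤ≡sum n (f ∘ fsuc))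

sumℤ-+ : ∀ n (f g : Fin n → ℤ) → sumℤ n (λ i → f i + g i) ≡ sumℤ n f + sumℤ n g
sumℤ-+ n f g = begin
  sumℤ n (λ i → f i + g i)       ≡⟨ sumℤ≡sum n _ ⟩
  ℤSum.sum (λ i → f i + g i)     ≡⟨ ℤSum.∑-distrib-+ f g ⟩
  ℤSum.sum f + ℤSum.sum g        ≡⟨ sym (cong₂ _+_ (sumℤ≡sum n f) (sumℤ≡sum n g)) ⟩
  sumℤ n f + sumℤ n g            ∎
  where open ≡-Reasoning

sumℤ-const : ∀ n a → sumℤ n (λ _ → a) ≡ + n * a
sumℤ-const zero    a = refl
sumℤ-const (suc n) a = begin
  a + sumℤ n (λ _ → a)   ≡⟨ cong (λ x → a + x) (sumℤ-const n a) ⟩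
  a + + n * a            ≡⟨ cong (λ x → x + + n * a) (ℤ.*-identityˡ a) ⟨
  1ℤ * a + + n * a       ≡⟨ ℤ.*-distribʳ-+ a 1ℤ (+ n) ⟨
  + suc n * a            ∎
  where open ≡-Reasoning

sumℤ-permute : ∀ n (f : Fin n → ℤ) (π : Permutation′ n) → sumℤ n (f ∘ (π ⟨$⟩ʳ_)) ≡ sumℤ n f
sumℤ-permute n f π = begin
  sumℤ n (f ∘ (π ⟨$⟩ʳ_))       ≡⟨ sumℤ≡sum n _ ⟩
  ℤSum.sum (f ∘ (π ⟨$⟩ʳ_))     ≡⟨ sym (ℤSum.sum-permute f π) ⟩
  ℤSum.sum f                   ≡⟨ sym (sumℤ≡sum n f) ⟩
  sumℤ n f                     ∎
  where open ≡-Reasoning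

sumℤ-cong-≈[mod] : ∀ {r} n {f g : Fin n → ℤ} → (∀ i → f i ≈[mod r ] g i) → sumℤ n f ≈[mod r ] sumℤ n g
sumℤ-cong-≈[mod] zero    f≈g = ≈[mod]-reflexive refl
sumℤ-cong-≈[mod] (suc n) f≈g = +-cong-≈[mod] (f≈g fzero) (sumℤ-cong-≈[mod] n (f≈g ∘ fsuc))

module TwistArithmetic (n r p q p' q' ρ ρ' s M σ : ℤ) .{{_ : ℤ.NonZero p}} .{{_ : ℤ.NonZero q'}}
  (r≡ρq : r ≡ ρ * q) (r≡ρ'q' : r ≡ ρ' * q') (pq≡p'q' : p * q ≡ p' * q')
  (p+sn≡p'M : p + s * n ≡ p' * M) (sq'≡pσ : s * q' ≡ p * σ) where

  open ≡-Reasoning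

  sr≡pσρ' : s * r ≡ p * σ * ρ'
  sr≡pσρ' = begin
    s * r             ≡⟨ cong (s *_) r≡ρ'q' ⟩
    s * (ρ' * q')     ≡⟨ solve (s ∷ ρ' ∷ q' ∷ []) ⟩
    ρ' * (s * q')     ≡⟨ cong (ρ' *_) sq'≡pσ ⟩
    ρ' * (p * σ)      ≡⟨ solve (ρ' ∷ p ∷ σ ∷ []) ⟩
    p * σ * ρ'        ∎

  ρp'≡ρ'p : ρ * p' ≡ ρ' * p
  ρp'≡ρ'p = ℤ.*-cancelʳ-≡ _ _ q' (begin
    ρ * p' * q'       ≡⟨ solve (ρ ∷ p' ∷ q' ∷ []) ⟩
    ρ * (p' * q')     ≡⟨ cong (ρ *_) pq≡p'q' ⟨
    ρ * (p * q)       ≡⟨ solve (ρ ∷ p ∷ q ∷ []) ⟩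
    ρ * q * p         ≡⟨ cong (_* p) r≡ρq ⟨
    r * p             ≡⟨ cong (_* p) r≡ρ'q' ⟩
    ρ' * q' * p       ≡⟨ solve (ρ' ∷ q' ∷ p ∷ []) ⟩
    ρ' * p * q'       ∎)

  sq≡p'σ : s * q ≡ p' * σ
  sq≡p'σ = ℤ.*-cancelʳ-≡ _ _ q' (begin
    s * q * q'        ≡⟨ solve (s ∷ q ∷ q' ∷ []) ⟩
    s * q' * q        ≡⟨ cong (_* q) sq'≡pσ ⟩
    p * σ * q         ≡⟨ solve (p ∷ σ ∷ q ∷ []) ⟩
    σ * (p * q)       ≡⟨ cong (σ *_) pq≡p'q' ⟩
    σ * (p' * q')     ≡⟨ solve (σ ∷ p' ∷ q' ∷ []) ⟩
    p' * σ * q'       ∎)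

  pk+nsk≡p'Mk : ∀ k → p * k + n * (s * k) ≡ p' * (M * k)
  pk+nsk≡p'Mk k = begin
    p * k + n * (s * k)   ≡⟨ solve (p ∷ n ∷ s ∷ k ∷ []) ⟩
    (p + s * n) * k       ≡⟨ cong (_* k) p+sn≡p'M ⟩
    p' * M * k            ≡⟨ solve (p' ∷ M ∷ k ∷ []) ⟩
    p' * (M * k)          ∎

  shift-exponent : ∀ k l c τ → p * l ≡ p * k + n * (c * ρ) + τ * r →
                   c * ρ + s * l ≡ s * k + (c * M + σ * τ) * ρ'
  shift-exponent k l c τ pl≡pk+ncρ+τr = ℤ.*-cancelˡ-≡ p _ _ (begin
    p * (c * ρ + s * l)                               ≡⟨ solve (p ∷ c ∷ ρ ∷ s ∷ l ∷ []) ⟩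
    c * ρ * p + s * (p * l)                           ≡⟨ cong (λ x → c * ρ * p + s * x) pl≡pk+ncρ+τr ⟩
    c * ρ * p + s * (p * k + n * (c * ρ) + τ * r)     ≡⟨ solve (c ∷ ρ ∷ p ∷ s ∷ k ∷ n ∷ τ ∷ r ∷ []) ⟩
    c * ρ * (p + s * n) + p * (s * k) + τ * (s * r)   ≡⟨ cong₂ (λ x y → c * ρ * x + p * (s * k) + τ * y) p+sn≡p'M sr≡pσρ' ⟩
    c * ρ * (p' * M) + p * (s * k) + τ * (p * σ * ρ') ≡⟨ solve (c ∷ ρ ∷ p' ∷ M ∷ p ∷ s ∷ k ∷ τ ∷ σ ∷ ρ' ∷ []) ⟩
    c * M * (ρ * p') + p * (s * k + σ * τ * ρ')       ≡⟨ cong (λ x → c * M * x + p * (s * k + σ * τ * ρ')) ρp'≡ρ'p ⟩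
    c * M * (ρ' * p) + p * (s * k + σ * τ * ρ')       ≡⟨ solve (c ∷ M ∷ ρ' ∷ p ∷ s ∷ k ∷ σ ∷ τ ∷ []) ⟩
    p * (s * k + (c * M + σ * τ) * ρ')                ∎)

  module Inverse (M̄ w π : ℤ) (MM̄≡1+wr : M * M̄ ≡ 1ℤ + w * r) (r≡πp : r ≡ π * p) where

    s' M' σ' : ℤ
    s' = - (s * M̄)
    M' = M̄ - p' * π * w
    σ' = - (M̄ * σ)

    p'+s'n≡pM' : p' + s' * n ≡ p * M'
    p'+s'n≡pM' = begin
      p' + - (s * M̄) * n                  ≡⟨ solve (p' ∷ s ∷ M̄ ∷ n ∷ p ∷ []) ⟩
      p' + M̄ * p - M̄ * (p + s * n)        ≡⟨ cong (λ x → p' + M̄ * p - M̄ * x) p+sn≡p'M ⟩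
      p' + M̄ * p - M̄ * (p' * M)           ≡⟨ solve (p' ∷ M̄ ∷ p ∷ M ∷ []) ⟩
      p * M̄ + p' * (1ℤ - M * M̄)           ≡⟨ cong (λ x → p * M̄ + p' * (1ℤ - x)) MM̄≡1+wr ⟩
      p * M̄ + p' * (1ℤ - (1ℤ + w * r))    ≡⟨ cong (λ x → p * M̄ + p' * (1ℤ - (1ℤ + w * x))) r≡πp ⟩
      p * M̄ + p' * (1ℤ - (1ℤ + w * (π * p))) ≡⟨ solve (p ∷ M̄ ∷ p' ∷ w ∷ π ∷ []) ⟩
      p * (M̄ - p' * π * w)                ∎

    s'q≡p'σ' : s' * q ≡ p' * σ'
    s'q≡p'σ' = begin
      - (s * M̄) * q          ≡⟨ solve (s ∷ M̄ ∷ q ∷ []) ⟩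
      - M̄ * (s * q)          ≡⟨ cong (λ x → - M̄ * x) sq≡p'σ ⟩
      - M̄ * (p' * σ)         ≡⟨ solve (M̄ ∷ p' ∷ σ ∷ []) ⟩
      p' * - (M̄ * σ)         ∎

    back-forth-exponent : ∀ k → s * k + s' * (M * k) ≡ - (s * k * w) * r
    back-forth-exponent k = begin
      s * k + - (s * M̄) * (M * k)   ≡⟨ solve (s ∷ k ∷ M̄ ∷ M ∷ []) ⟩
      s * k - s * k * (M * M̄)       ≡⟨ cong (λ x → s * k - s * k * x) MM̄≡1+wr ⟩
      s * k - s * k * (1ℤ + w * r)  ≡⟨ solve (s ∷ k ∷ w ∷ r ∷ []) ⟩
      - (s * k * w) * r             ∎

    sπ≡σρ' : s * π ≡ σ * ρ'
    sπ≡σρ' = ℤ.*-cancelˡ-≡ p _ _ (begin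
      p * (s * π)      ≡⟨ solve (p ∷ s ∷ π ∷ []) ⟩
      s * (π * p)      ≡⟨ cong (s *_) r≡πp ⟨
      s * r            ≡⟨ sr≡pσρ' ⟩
      p * σ * ρ'       ≡⟨ solve (p ∷ σ ∷ ρ' ∷ []) ⟩
      p * (σ * ρ')     ∎)

    forth-back-exponent : ∀ k → s' * k + s * (M' * k) ≡ - (p' * w * k * σ) * ρ'
    forth-back-exponent k = begin
      - (s * M̄) * k + s * ((M̄ - p' * π * w) * k) ≡⟨ solve (s ∷ M̄ ∷ k ∷ p' ∷ π ∷ w ∷ []) ⟩
      - (p' * w * k) * (s * π)   ≡⟨ cong (λ x → - (p' * w * k) * x) sπ≡σρ' ⟩
      - (p' * w * k) * (σ * ρ')  ≡⟨ solve (p' ∷ w ∷ k ∷ σ ∷ ρ' ∷ []) ⟩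
      - (p' * w * k * σ) * ρ'    ∎

-- g ⊕ a is g c^a, where c = ζ_r I_n.
infixl 6 _⊕_

_⊕_ : ∀ {n} → GElem n → ℤ → GElem n
g ⊕ a = ⟨ perm g , (λ i → exps g i + a) ⟩

Δ-⊕ : ∀ {n} (g : GElem n) a → Δ (g ⊕ a) ≡ Δ g + + n * a
Δ-⊕ {n} g a = trans (sumℤ-+ n (exps g) (λ _ → a)) (cong (λ x → Δ g + x) (sumℤ-const n a))

Δ-· : ∀ {n} (g h : GElem n) → Δ (g · h) ≡ Δ g + Δ h
Δ-· {n} ⟨ π , x ⟩ ⟨ σ , y ⟩ =
  trans (sumℤ-+ n (x ∘ (σ ⟨$⟩ʳ_)) y) (cong (λ z → z + sumℤ n y) (sumℤ-permute n x σ))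

Δ-cong-⊕ : ∀ {r n} (g h : GElem n) {a} → (∀ i → exps h i ≈[mod r ] exps g i + a) →
           Δ h ≈[mod r ] Δ g + + n * a
Δ-cong-⊕ {r} {n} g h {a} h≈g+a = begin
  Δ h            ≈⟨ sumℤ-cong-≈[mod] n h≈g+a ⟩
  Δ (g ⊕ a)      ≡⟨ Δ-⊕ g a ⟩
  Δ g + + n * a  ∎
  where open SetoidReasoning (≈[mod]-setoid r)

Coset : ℕ → ℤ → ∀ {n} → GElem n → GElem n → Set
Coset r ρ g h = (∀ i → perm g ⟨$⟩ʳ i ≡ perm h ⟨$⟩ʳ i) × ∃ λ k → ∀ i → exps h i ≡[mod r ] (exps g i + k * ρ)

x+aρ+bρ≡x+[a+b]ρ : ∀ x a b ρ → x + a * ρ + b * ρ ≡ x + (a + b) * ρ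
x+aρ+bρ≡x+[a+b]ρ = solve-∀

module _ {r : ℕ} {ρ : ℤ} {n : ℕ} where

  open SetoidReasoning (≈[mod]-setoid r)

  coset-sym : (g h : GElem n) → Coset r ρ g h → Coset r ρ h g
  coset-sym g h (π≗σ , c , h≡g+cρ) = (sym ∘ π≗σ) , - c , λ i → mod-elim (begin
    exps g i                     ≡⟨ ℤ.+-identityʳ (exps g i) ⟨
    exps g i + 0ℤ                ≡⟨ cong (λ x → exps g i + x * ρ) (ℤ.+-inverseʳ c) ⟨
    exps g i + (c + - c) * ρ     ≡⟨ x+aρ+bρ≡x+[a+b]ρ (exps g i) c (- c) ρ ⟨
    exps g i + c * ρ + - c * ρ   ≈⟨ +-congʳ-≈[mod] (- c * ρ) (≈[mod]-sym (h≈g+cρ i)) ⟩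
    exps h i + - c * ρ           ∎)
    where
    h≈g+cρ : ∀ i → exps h i ≈[mod r ] exps g i + c * ρ
    h≈g+cρ i = mod-intro (h≡g+cρ i)

  coset-trans : (g h k : GElem n) → Coset r ρ g h → Coset r ρ h k → Coset r ρ g k
  coset-trans g h k (π≗σ , c , h≡g+cρ) (σ≗τ , d , k≡h+dρ) =
    (λ i → trans (π≗σ i) (σ≗τ i)) , c + d , λ i → mod-elim (begin
      exps k i                   ≈⟨ k≈h+dρ i ⟩
      exps h i + d * ρ           ≈⟨ +-congʳ-≈[mod] (d * ρ) (h≈g+cρ i) ⟩
      exps g i + c * ρ + d * ρ   ≡⟨ x+aρ+bρ≡x+[a+b]ρ (exps g i) c d ρ ⟩
      exps g i + (c + d) * ρ     ∎)
    where
    h≈g+cρ : ∀ i → exps h i ≈[mod r ] exps g i + c * ρ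
    h≈g+cρ i = mod-intro (h≡g+cρ i)
    k≈h+dρ : ∀ i → exps k i ≈[mod r ] exps h i + d * ρ
    k≈h+dρ i = mod-intro (k≡h+dρ i)

  coset-refl : (g : GElem n) → Coset r ρ g g
  coset-refl g = (λ _ → refl) , 0ℤ , λ i → mod-elim (≈[mod]-reflexive (sym (ℤ.+-identityʳ (exps g i))))

  ·-⊕-coset : (g h : GElem n) {a b c : ℤ} → a ≡ b + c → Coset r ρ ((g · h) ⊕ a) ((g ⊕ b) · (h ⊕ c))
  ·-⊕-coset g h {a} {b} {c} a≡b+c = (λ _ → refl) , 0ℤ , λ i → mod-elim (begin
    exps g (perm h ⟨$⟩ʳ i) + b + (exps h i + c)    ≡⟨ interchange (exps g (perm h ⟨$⟩ʳ i)) b (exps h i) c ⟩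
    exps g (perm h ⟨$⟩ʳ i) + exps h i + (b + c)    ≡⟨ cong (λ x → exps g (perm h ⟨$⟩ʳ i) + exps h i + x) a≡b+c ⟨
    exps g (perm h ⟨$⟩ʳ i) + exps h i + a          ≡⟨ ℤ.+-identityʳ _ ⟨
    exps g (perm h ⟨$⟩ʳ i) + exps h i + a + 0ℤ     ∎)

module TwistMap (r n : ℕ) (p q p' q' ρ ρ' s M σ : ℤ) .{{_ : ℤ.NonZero p}} .{{_ : ℤ.NonZero q'}}
  (r≡ρq : + r ≡ ρ * q) (r≡ρ'q' : + r ≡ ρ' * q') (pq≡p'q' : p * q ≡ p' * q')
  (p+sn≡p'M : p + s * + n ≡ p' * M) (sq'≡pσ : s * q' ≡ p * σ) where

  open TwistArithmetic (+ n) (+ r) p q p' q' ρ ρ' s M σ r≡ρq r≡ρ'q' pq≡p'q' p+sn≡p'M sq'≡pσ public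
  open SetoidReasoning (≈[mod]-setoid r)

  twist : GElem n → ℤ → GElem n
  twist g k = g ⊕ s * k

  twist-mem : ∀ g k → Δ g ≈[mod r ] p * k → Δ (twist g k) ≈[mod r ] p' * (M * k)
  twist-mem g k Δg≈pk = begin
    Δ (g ⊕ s * k)         ≡⟨ Δ-⊕ g (s * k) ⟩
    Δ g + + n * (s * k)   ≈⟨ +-congʳ-≈[mod] (+ n * (s * k)) Δg≈pk ⟩
    p * k + + n * (s * k) ≡⟨ pk+nsk≡p'Mk k ⟩
    p' * (M * k)          ∎

  twist-cong : ∀ g h k l → Δ g ≈[mod r ] p * k → Δ h ≈[mod r ] p * l →
               Coset r ρ g h → Coset r ρ' (twist g k) (twist h l)
  twist-cong g h k l Δg≈pk Δh≈pl (π≗σ , c , h≡g+cρ) = π≗σ , c * M + σ * τ , λ i → mod-elim (begin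
    exps h i + s * l                           ≈⟨ +-congʳ-≈[mod] (s * l) (h≈g+cρ i) ⟩
    exps g i + c * ρ + s * l                   ≡⟨ ℤ.+-assoc (exps g i) (c * ρ) (s * l) ⟩
    exps g i + (c * ρ + s * l)                 ≡⟨ cong (λ x → exps g i + x) (shift-exponent k l c τ pl≡pk+ncρ+τr) ⟩
    exps g i + (s * k + (c * M + σ * τ) * ρ')  ≡⟨ ℤ.+-assoc (exps g i) (s * k) _ ⟨
    exps g i + s * k + (c * M + σ * τ) * ρ'    ∎)
    where
    h≈g+cρ : ∀ i → exps h i ≈[mod r ] exps g i + c * ρ
    h≈g+cρ i = mod-intro (h≡g+cρ i)
    pl≈pk+ncρ : p * l ≈[mod r ] p * k + + n * (c * ρ)
    pl≈pk+ncρ = begin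
      p * l                  ≈⟨ ≈[mod]-sym Δh≈pl ⟩
      Δ h                    ≈⟨ Δ-cong-⊕ g h h≈g+cρ ⟩
      Δ g + + n * (c * ρ)    ≈⟨ +-congʳ-≈[mod] (+ n * (c * ρ)) Δg≈pk ⟩
      p * k + + n * (c * ρ)  ∎
    τ : ℤ
    τ = proj₁ (≈[mod]⇒∃ pl≈pk+ncρ)
    pl≡pk+ncρ+τr : p * l ≡ p * k + + n * (c * ρ) + τ * + r
    pl≡pk+ncρ+τr = proj₂ (≈[mod]⇒∃ pl≈pk+ncρ)

  twist-hom : ∀ g h k l m → Δ g ≈[mod r ] p * k → Δ h ≈[mod r ] p * l → Δ (g · h) ≈[mod r ] p * m →
              Coset r ρ' (twist (g · h) m) (twist g k · twist h l)
  twist-hom g h k l m Δg≈pk Δh≈pl Δgh≈pm =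
    coset-trans (twist (g · h) m) (twist (g · h) (k + l)) (twist g k · twist h l)
      (twist-cong (g · h) (g · h) m (k + l) Δgh≈pm Δgh≈p[k+l] (coset-refl (g · h)))
      (·-⊕-coset g h (ℤ.*-distribˡ-+ s k l))
    where
    Δgh≈p[k+l] : Δ (g · h) ≈[mod r ] p * (k + l)
    Δgh≈p[k+l] = begin
      Δ (g · h)       ≡⟨ Δ-· g h ⟩
      Δ g + Δ h       ≈⟨ +-cong-≈[mod] Δg≈pk Δh≈pl ⟩
      p * k + p * l   ≡⟨ ℤ.*-distribˡ-+ p k l ⟨
      p * (k + l)     ∎

record Twist (r n p q p' q' : ℕ) : Set where
  field
    s M σ : ℤ
    p+sn≡p'M : + p + s * + n ≡ + p' * M
    sq'≡pσ : s * + q' ≡ + p * σ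
    M̄ w : ℤ
    MM̄≡1+wr : M * M̄ ≡ 1ℤ + w * + r

pos-≡-* : ∀ {a} b c → a ≡ b ℕ.* c → + a ≡ + b * + c
pos-≡-* b c refl = ℤ.pos-* b c

module TwistIsomorphism {r n p q p' q' : ℕ} (qr : q ∣ r) (q'r : q' ∣ r) (pr : p ∣ r)
  .{{_ : ℕ.NonZero p}} .{{_ : ℕ.NonZero q}} .{{_ : ℕ.NonZero p'}} .{{_ : ℕ.NonZero q'}}
  (pq≡p'q' : p ℕ.* q ≡ p' ℕ.* q') (t : Twist r n p q p' q') where

  open Twist t

  ρ ρ' π : ℤ
  ρ = + quotient qr
  ρ' = + quotient q'r
  π = + quotient pr

  private
    r≡ρq : + r ≡ ρ * + q
    r≡ρq = pos-≡-* (quotient qr) q (ℕ._∣_.equality qr)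
    r≡ρ'q' : + r ≡ ρ' * + q'
    r≡ρ'q' = pos-≡-* (quotient q'r) q' (ℕ._∣_.equality q'r)
    r≡πp : + r ≡ π * + p
    r≡πp = pos-≡-* (quotient pr) p (ℕ._∣_.equality pr)
    pq≡p'q'ℤ : + p * + q ≡ + p' * + q'
    pq≡p'q'ℤ = trans (sym (ℤ.pos-* p q)) (pos-≡-* p' q' pq≡p'q')

  module Forth = TwistMap r n (+ p) (+ q) (+ p') (+ q') ρ ρ' s M σ r≡ρq r≡ρ'q' pq≡p'q'ℤ p+sn≡p'M sq'≡pσ
  open Forth.Inverse M̄ w π MM̄≡1+wr r≡πp
  module Back = TwistMap r n (+ p') (+ q') (+ p) (+ q) ρ' ρ s' M' σ' r≡ρ'q' r≡ρq (sym pq≡p'q'ℤ) p'+s'n≡pM' s'q≡p'σ'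

  back-forth : ∀ g k → Coset r ρ g (Back.twist (Forth.twist g k) (M * k))
  back-forth g k = (λ _ → refl) , 0ℤ , λ i → mod-elim (begin
    exps g i + s * k + s' * (M * k)      ≡⟨ ℤ.+-assoc (exps g i) (s * k) (s' * (M * k)) ⟩
    exps g i + (s * k + s' * (M * k))    ≡⟨ cong (λ x → exps g i + x) (back-forth-exponent k) ⟩
    exps g i + - (s * k * w) * + r       ≈⟨ +-multiple-≈[mod] (exps g i) (- (s * k * w)) ⟩
    exps g i                             ≡⟨ ℤ.+-identityʳ (exps g i) ⟨
    exps g i + 0ℤ                        ∎)
    where open SetoidReasoning (≈[mod]-setoid r)

  forth-back : ∀ h k → Coset r ρ' (Forth.twist (Back.twist h k) (M' * k)) h
  forth-back h k = (λ _ → refl) , c , λ i → mod-elim (begin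
    exps h i                                      ≡⟨ ℤ.+-identityʳ (exps h i) ⟨
    exps h i + 0ℤ                                 ≡⟨ cong (λ x → exps h i + x * ρ') (ℤ.+-inverseˡ c) ⟨
    exps h i + (- c + c) * ρ'                     ≡⟨ x+aρ+bρ≡x+[a+b]ρ (exps h i) (- c) c ρ' ⟨
    exps h i + - c * ρ' + c * ρ'                  ≡⟨ cong (λ x → exps h i + x + c * ρ') (forth-back-exponent k) ⟨
    exps h i + (s' * k + s * (M' * k)) + c * ρ'   ≡⟨ cong (_+ c * ρ') (ℤ.+-assoc (exps h i) (s' * k) (s * (M' * k))) ⟨
    exps h i + s' * k + s * (M' * k) + c * ρ'     ∎)
    where
    open SetoidReasoning (≈[mod]-setoid r)
    c : ℤ
    c = + p' * w * k * σ

  twist-injective : ∀ g h k l → Δ g ≈[mod r ] + p * k → Δ h ≈[mod r ] + p * l →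
                    Coset r ρ' (Forth.twist g k) (Forth.twist h l) → Coset r ρ g h
  twist-injective g h k l Δg≈pk Δh≈pl twist∼ =
    coset-trans g g′ h (back-forth g k)
      (coset-trans g′ h′ h
        (Back.twist-cong (Forth.twist g k) (Forth.twist h l) (M * k) (M * l)
          (Forth.twist-mem g k Δg≈pk) (Forth.twist-mem h l Δh≈pl) twist∼)
        (coset-sym h h′ (back-forth h l)))
    where
    g′ h′ : GElem n
    g′ = Back.twist (Forth.twist g k) (M * k)
    h′ = Back.twist (Forth.twist h l) (M * l)

  isomorphism : QuotIso r n p q p' q' qr q'r
  isomorphism = record
    { f      = λ { g (k , _) → Forth.twist g k }
    ; f-mem  = λ { g (k , Δg≡pk) → M * k , mod-elim (Forth.twist-mem g k (mod-intro Δg≡pk)) }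
    ; f-cong = λ { g h (k , Δg≡pk) (l , Δh≡pl) →
                   Forth.twist-cong g h k l (mod-intro Δg≡pk) (mod-intro Δh≡pl) }
    ; f-hom  = λ { g h (k , Δg≡pk) (l , Δh≡pl) (m , Δgh≡pm) →
                   Forth.twist-hom g h k l m (mod-intro Δg≡pk) (mod-intro Δh≡pl) (mod-intro Δgh≡pm) }
    ; f-inj  = λ { g h (k , Δg≡pk) (l , Δh≡pl) → twist-injective g h k l (mod-intro Δg≡pk) (mod-intro Δh≡pl) }
    ; f-surj = λ { h (k , Δh≡p'k) →
                   Back.twist h k , (M' * k , mod-elim (Back.twist-mem h k (mod-intro Δh≡p'k))) , forth-back h k }
    }

coprime-∣ˡ : ∀ {a b c} → Coprime a b → c ∣ a → Coprime c b
coprime-∣ˡ a⊥b c∣a (i∣c , i∣b) = a⊥b (ℕ.∣-trans i∣c c∣a , i∣b)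

coprime-∣ʳ : ∀ {a b c} → Coprime a b → c ∣ b → Coprime a c
coprime-∣ʳ a⊥b c∣b = Coprime.sym (coprime-∣ˡ (Coprime.sym a⊥b) c∣b)

coprime-*ʳ : ∀ {a b c} → Coprime a b → Coprime a c → Coprime a (b ℕ.* c)
coprime-*ʳ a⊥b a⊥c (i∣a , i∣bc) = a⊥c (i∣a , coprime-divisor (coprime-∣ˡ a⊥b i∣a) i∣bc)

m*n∣n⇒m≡1 : ∀ {m} n .{{_ : ℕ.NonZero n}} → m ℕ.* n ∣ n → m ≡ 1
m*n∣n⇒m≡1 {m} n mn∣n = ℕ.∣1⇒≡1 (ℕ.*-cancelʳ-∣ n (subst (m ℕ.* n ∣_) (sym (ℕ.*-identityˡ n)) mn∣n))

pos-1+*≡* : ∀ a b c d → 1 ℕ.+ a ℕ.* b ≡ c ℕ.* d → 1ℤ + + a * + b ≡ + c * + d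
pos-1+*≡* a b c d 1+ab≡cd = begin
  1ℤ + + a * + b       ≡⟨ cong (λ x → 1ℤ + x) (ℤ.pos-* a b) ⟨
  1ℤ + + (a ℕ.* b)     ≡⟨ ℤ.pos-+ 1 (a ℕ.* b) ⟨
  + (1 ℕ.+ a ℕ.* b)    ≡⟨ cong +_ 1+ab≡cd ⟩
  + (c ℕ.* d)          ≡⟨ ℤ.pos-* c d ⟩
  + c * + d            ∎
  where open ≡-Reasoning

inverse-modulo : ∀ {m r} → Coprime m r → ∃₂ λ m̄ w → + m * m̄ ≡ 1ℤ + w * + r
inverse-modulo {m} {r} m⊥r with coprime-Bézout m⊥r
... | Bézout.+- x y 1+yr≡xm = + x , + y , trans (ℤ.*-comm (+ m) (+ x)) (sym (pos-1+*≡* y r x m 1+yr≡xm))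
... | Bézout.-+ x y 1+xm≡yr = - + x , - + y , negate (+ m) (+ x) (+ y) (+ r) (pos-1+*≡* x m y r 1+xm≡yr)
  where
  negate : ∀ M X Y R → 1ℤ + X * M ≡ Y * R → M * - X ≡ 1ℤ + - Y * R
  negate M X Y R 1+XM≡YR = begin
    M * - X                ≡⟨ solve (M ∷ X ∷ []) ⟩
    1ℤ - (1ℤ + X * M)      ≡⟨ cong (λ z → 1ℤ - z) 1+XM≡YR ⟩
    1ℤ - Y * R             ≡⟨ solve (Y ∷ R ∷ []) ⟩
    1ℤ + - Y * R           ∎
    where open ≡-Reasoning

unit⇒coprime : ∀ {α a b t} → + α * + a ≡ 1ℤ + t * + b → Coprime α b
unit⇒coprime {α} {a} {b} {t} αa≡1+tb {i} (i∣α , i∣b) =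
  ℕ.∣1⇒≡1 (ℤ∣.∣⇒∣ᵤ {i = 1ℤ} (ℤ∣.∣m+n∣n⇒∣m i∣1+tb i∣tb))
  where
  i∣1+tb : + i ℤ∣.∣ 1ℤ + t * + b
  i∣1+tb = subst (+ i ℤ∣.∣_) αa≡1+tb (ℤ∣.∣m⇒∣m*n (+ a) (ℤ∣.∣ᵤ⇒∣ {i = + α} i∣α))
  i∣tb : + i ℤ∣.∣ t * + b
  i∣tb = ℤ∣.∣n⇒∣m*n t (ℤ∣.∣ᵤ⇒∣ {i = + b} i∣b)

natural-inverse-modulo : ∀ {a b} .{{_ : ℕ.NonZero b}} → Coprime a b → ∃₂ λ α t → + α * + a ≡ 1ℤ + t * + b
natural-inverse-modulo {a} {b} a⊥b with inverse-modulo a⊥b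
... | ā , w , aā≡1+wb = ā %ℕ b , w - ā /ℕ b * + a ,
  reduce (+ (ā %ℕ b)) (ā /ℕ b) ā (+ a) (+ b) w (a≡a%ℕn+[a/ℕn]*n ā b) aā≡1+wb
  where
  reduce : ∀ A d ā a b w → ā ≡ A + d * b → a * ā ≡ 1ℤ + w * b → A * a ≡ 1ℤ + (w - d * a) * b
  reduce A d ā a b w ā≡A+db aā≡1+wb = begin
    A * a                          ≡⟨ solve (A ∷ a ∷ d ∷ b ∷ []) ⟩
    a * (A + d * b) - d * a * b    ≡⟨ cong (λ z → a * z - d * a * b) ā≡A+db ⟨
    a * ā - d * a * b              ≡⟨ cong (λ z → z - d * a * b) aā≡1+wb ⟩
    1ℤ + w * b - d * a * b         ≡⟨ solve (w ∷ b ∷ d ∷ a ∷ []) ⟩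
    1ℤ + (w - d * a) * b           ∎
    where open ≡-Reasoning

CoprimeSplit : ℕ → ℕ → Set
CoprimeSplit A C = ∃₂ λ K J → C ≡ K ℕ.* J × Coprime J A × (∀ {c} → c ∣ K → Coprime c A → c ≡ 1)

coprime-split : ∀ A C .{{_ : ℕ.NonZero C}} → CoprimeSplit A C
coprime-split A = <-rec (λ C → .{{_ : ℕ.NonZero C}} → CoprimeSplit A C) split
  where
  split : ∀ C → (∀ {C'} → C' < C → .{{_ : ℕ.NonZero C'}} → CoprimeSplit A C') → .{{_ : ℕ.NonZero C}} → CoprimeSplit A C
  split C rec with gcd C A | gcd-GCD C A
  ... | 0               | G = contradiction (ℕ.0∣⇒≡0 (GCD.gcd∣m G)) (ℕ.≢-nonZero⁻¹ C)
  ... | 1               | G = 1 , C , sym (ℕ.*-identityˡ C) , GCD≡1⇒coprime G , λ c∣1 _ → ℕ.∣1⇒≡1 c∣1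
  ... | g@(suc (suc _)) | G
    with rec (ℕ.quotient-< (GCD.gcd∣m G)) {{ℕ.quotient≢0 (GCD.gcd∣m G)}}
  ... | K , J , C/g≡KJ , J⊥A , K-supported = g ℕ.* K , J , C≡gKJ , J⊥A , gK-supported
    where
    C≡gKJ : C ≡ g ℕ.* K ℕ.* J
    C≡gKJ = begin
      C                              ≡⟨ ℕ._∣_.equality (GCD.gcd∣m G) ⟩
      quotient (GCD.gcd∣m G) ℕ.* g   ≡⟨ cong (ℕ._* g) C/g≡KJ ⟩
      K ℕ.* J ℕ.* g                  ≡⟨ ℕ.*-comm (K ℕ.* J) g ⟩
      g ℕ.* (K ℕ.* J)                ≡⟨ ℕ.*-assoc g K J ⟨
      g ℕ.* K ℕ.* J                  ∎
      where open ≡-Reasoning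
    gK-supported : ∀ {c} → c ∣ g ℕ.* K → Coprime c A → c ≡ 1
    gK-supported c∣gK c⊥A = K-supported (coprime-divisor (coprime-∣ʳ c⊥A (GCD.gcd∣n G)) c∣gK) c⊥A

-- j is the part of C prime to A: its primes divide j B but not A, and the other primes of C
-- divide A but not j B.
coprime-shift : ∀ {A B} C .{{_ : ℕ.NonZero C}} → Coprime A B → ∃ λ j → Coprime (A ℕ.+ j ℕ.* B) C
coprime-shift {A} {B} C A⊥B with coprime-split A C
... | K , J , C≡KJ , J⊥A , K-supported = J , A+JB⊥C
  where
  A⊥JB : Coprime A (J ℕ.* B)
  A⊥JB = coprime-*ʳ (Coprime.sym J⊥A) A⊥B
  A+JB⊥C : Coprime (A ℕ.+ J ℕ.* B) C
  A+JB⊥C {i} (i∣A+JB , i∣C) = J⊥A (i∣J , i∣A)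
    where
    i⊥K : Coprime i K
    i⊥K (c∣i , c∣K) = K-supported c∣K λ (d∣c , d∣A) →
      A⊥JB (d∣A , ℕ.∣m+n∣m⇒∣n (ℕ.∣-trans d∣c (ℕ.∣-trans c∣i i∣A+JB)) d∣A)
    i∣J : i ∣ J
    i∣J = coprime-divisor i⊥K (subst (i ∣_) C≡KJ i∣C)
    i∣A : i ∣ A
    i∣A = ℕ.∣m+n∣m⇒∣n (subst (i ∣_) (ℕ.+-comm A (J ℕ.* B)) i∣A+JB) (ℕ.∣m⇒∣m*n B i∣J)

unit-solution : ∀ {P P' B} r .{{_ : ℕ.NonZero B}} .{{_ : ℕ.NonZero r}} → Coprime P B → Coprime P' B →
                ∃₂ λ τ M → + P + τ * + B ≡ + P' * + M × Coprime M r
unit-solution {P} {P'} {B} r P⊥B P'⊥B = from-inverse (natural-inverse-modulo P'⊥B)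
  where
  from-inverse : (∃₂ λ α t → + α * + P' ≡ 1ℤ + t * + B) → ∃₂ λ τ M → + P + τ * + B ≡ + P' * + M × Coprime M r
  from-inverse (α , t , αP'≡1+tB) =
    + P * t + + j * + P' , P ℕ.* α ℕ.+ j ℕ.* B , P+τB≡P'M , M⊥r
    where
    Pα⊥B : Coprime (P ℕ.* α) B
    Pα⊥B = Coprime.sym (coprime-*ʳ (Coprime.sym P⊥B) (Coprime.sym (unit⇒coprime {t = t} αP'≡1+tB)))
    j : ℕ
    j = proj₁ (coprime-shift r Pα⊥B)
    M⊥r : Coprime (P ℕ.* α ℕ.+ j ℕ.* B) r
    M⊥r = proj₂ (coprime-shift r Pα⊥B)
    solution : ∀ P P' B α t j → α * P' ≡ 1ℤ + t * B → P + (P * t + j * P') * B ≡ P' * (P * α + j * B)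
    solution P P' B α t j αP'≡1+tB = begin
      P + (P * t + j * P') * B       ≡⟨ solve (P ∷ t ∷ j ∷ P' ∷ B ∷ []) ⟩
      P * (1ℤ + t * B) + j * B * P'  ≡⟨ cong (λ z → P * z + j * B * P') αP'≡1+tB ⟨
      P * (α * P') + j * B * P'      ≡⟨ solve (P ∷ α ∷ P' ∷ j ∷ B ∷ []) ⟩
      P' * (P * α + j * B)           ∎
      where open ≡-Reasoning
    P+τB≡P'M : + P + (+ P * t + + j * + P') * + B ≡ + P' * + (P ℕ.* α ℕ.+ j ℕ.* B)
    P+τB≡P'M = begin
      + P + (+ P * t + + j * + P') * + B    ≡⟨ solution (+ P) (+ P') (+ B) (+ α) t (+ j) αP'≡1+tB ⟩
      + P' * (+ P * + α + + j * + B)        ≡⟨ cong (+ P' *_) (cong₂ _+_ (ℤ.pos-* P α) (ℤ.pos-* j B)) ⟨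
      + P' * (+ (P ℕ.* α) + + (j ℕ.* B))    ≡⟨ cong (+ P' *_) (ℤ.pos-+ (P ℕ.* α) (j ℕ.* B)) ⟨
      + P' * + (P ℕ.* α ℕ.+ j ℕ.* B)        ∎
      where open ≡-Reasoning

cancel-cofactor : ∀ {P P' X n c w} .{{_ : ℕ.NonZero w}} → Coprime P P' → gcd (P ℕ.* X) n ≡ gcd (P' ℕ.* X) n →
                  c ∣ P' → w ∣ X → c ℕ.* w ∣ n → c ℕ.* w ∣ X
cancel-cofactor {P} {P'} {_} {n} {c} {w} P⊥P' gcd-eq c∣P' (divides-refl Y) cw∣n = ℕ.*-monoˡ-∣ w c∣Y
  where
  cw∣PYw : c ℕ.* w ∣ P ℕ.* (Y ℕ.* w)
  cw∣PYw = ℕ.∣-trans (subst (c ℕ.* w ∣_) (sym gcd-eq) (gcd-greatest (ℕ.*-pres-∣ c∣P' (ℕ.n∣m*n Y)) cw∣n))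
                     (gcd[m,n]∣m (P ℕ.* (Y ℕ.* w)) n)
  c∣Y : c ∣ Y
  c∣Y = coprime-divisor (coprime-∣ˡ (Coprime.sym P⊥P') c∣P')
          (ℕ.*-cancelʳ-∣ w (subst (c ℕ.* w ∣_) (sym (ℕ.*-assoc P Y w)) cw∣PYw))

coprime-cofactor : ∀ {P P' d Q n B} .{{_ : ℕ.NonZero n}} → Coprime P P' →
                   gcd (P ℕ.* d) n ≡ gcd (P' ℕ.* d) n → gcd (P ℕ.* Q) n ≡ gcd (P' ℕ.* Q) n →
                   n ≡ B ℕ.* gcd d (gcd n Q) → Coprime P' B
coprime-cofactor {P} {P'} {d} {Q} {n} {B} P⊥P' gcd-d gcd-Q n≡Bg {c} (c∣P' , c∣B) = m*n∣n⇒m≡1 g cg∣g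
  where
  g : ℕ
  g = gcd d (gcd n Q)
  instance
    g≢0 : ℕ.NonZero g
    g≢0 = ℕ.≢-nonZero (gcd[m,n]≢0 d _ (inj₂ (gcd[m,n]≢0 n Q (inj₁ (ℕ.≢-nonZero⁻¹ n)))))
  cg∣n : c ℕ.* g ∣ n
  cg∣n = subst (c ℕ.* g ∣_) (sym n≡Bg) (ℕ.*-monoˡ-∣ g c∣B)
  cg∣g : c ℕ.* g ∣ g
  cg∣g = gcd-greatest (cancel-cofactor P⊥P' gcd-d c∣P' (gcd[m,n]∣m d _) cg∣n)
           (gcd-greatest cg∣n (cancel-cofactor P⊥P' gcd-Q c∣P' (ℕ.∣-trans (gcd[m,n]∣n d _) (gcd[m,n]∣n n Q)) cg∣n))

coprime-proportion : ∀ {P P' q q'} .{{_ : ℕ.NonZero P'}} → Coprime P P' → P ℕ.* q ≡ P' ℕ.* q' →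
                     ∃ λ Q → q ≡ P' ℕ.* Q × q' ≡ P ℕ.* Q
coprime-proportion {P} {P'} {q} {q'} P⊥P' Pq≡P'q' = Q , q≡P'Q , q'≡PQ
  where
  P'∣q : P' ∣ q
  P'∣q = coprime-divisor (Coprime.sym P⊥P') (divides q' (trans Pq≡P'q' (ℕ.*-comm P' q')))
  Q : ℕ
  Q = quotient P'∣q
  q≡P'Q : q ≡ P' ℕ.* Q
  q≡P'Q = trans (ℕ._∣_.equality P'∣q) (ℕ.*-comm Q P')
  q'≡PQ : q' ≡ P ℕ.* Q
  q'≡PQ = ℕ.*-cancelˡ-≡ q' (P ℕ.* Q) P' (begin
    P' ℕ.* q'         ≡⟨ Pq≡P'q' ⟨
    P ℕ.* q           ≡⟨ cong (P ℕ.*_) q≡P'Q ⟩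
    P ℕ.* (P' ℕ.* Q)  ≡⟨ ℕ.*-comm P (P' ℕ.* Q) ⟩
    P' ℕ.* Q ℕ.* P    ≡⟨ ℕ.*-assoc P' Q P ⟩
    P' ℕ.* (Q ℕ.* P)  ≡⟨ cong (P' ℕ.*_) (ℕ.*-comm Q P) ⟩
    P' ℕ.* (P ℕ.* Q)  ∎)
    where open ≡-Reasoning

twist-from-factors : ∀ {r n p q p' q'} P P' D Q₁ g B .{{_ : ℕ.NonZero B}} .{{_ : ℕ.NonZero r}} →
                     n ≡ B ℕ.* g → p ≡ P ℕ.* (D ℕ.* g) → q ≡ P' ℕ.* (Q₁ ℕ.* g) →
                     p' ≡ P' ℕ.* (D ℕ.* g) → q' ≡ P ℕ.* (Q₁ ℕ.* g) →
                     Coprime P B → Coprime P' B → Twist r n p q p' q'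
twist-from-factors {r} P P' D Q₁ g B refl refl refl refl refl P⊥B P'⊥B = from-solution (unit-solution r P⊥B P'⊥B)
  where
  pos-*³ : ∀ a b c → + (a ℕ.* (b ℕ.* c)) ≡ + a * (+ b * + c)
  pos-*³ a b c = trans (ℤ.pos-* a (b ℕ.* c)) (cong (+ a *_) (ℤ.pos-* b c))
  relation : ∀ P P' D g B τ M → P + τ * B ≡ P' * M → P * (D * g) + D * τ * (B * g) ≡ P' * (D * g) * M
  relation P P' D g B τ M P+τB≡P'M = begin
    P * (D * g) + D * τ * (B * g)   ≡⟨ solve (P ∷ D ∷ g ∷ τ ∷ B ∷ []) ⟩
    D * g * (P + τ * B)             ≡⟨ cong (D * g *_) P+τB≡P'M ⟩
    D * g * (P' * M)                ≡⟨ solve (D ∷ g ∷ P' ∷ M ∷ []) ⟩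
    P' * (D * g) * M                ∎
    where open ≡-Reasoning
  rearrange : ∀ P D Q₁ g τ → D * τ * (P * (Q₁ * g)) ≡ P * (D * g) * (τ * Q₁)
  rearrange = solve-∀
  from-solution : (∃₂ λ τ M → + P + τ * + B ≡ + P' * + M × Coprime M r) →
                  Twist r (B ℕ.* g) (P ℕ.* (D ℕ.* g)) (P' ℕ.* (Q₁ ℕ.* g)) (P' ℕ.* (D ℕ.* g)) (P ℕ.* (Q₁ ℕ.* g))
  from-solution (τ , M , P+τB≡P'M , M⊥r) = record
    { s = + D * τ
    ; M = + M
    ; σ = τ * + Q₁
    ; p+sn≡p'M = begin
        + (P ℕ.* (D ℕ.* g)) + + D * τ * + (B ℕ.* g)  ≡⟨ cong₂ (λ x y → x + + D * τ * y) (pos-*³ P D g) (ℤ.pos-* B g) ⟩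
        + P * (+ D * + g) + + D * τ * (+ B * + g)    ≡⟨ relation (+ P) (+ P') (+ D) (+ g) (+ B) τ (+ M) P+τB≡P'M ⟩
        + P' * (+ D * + g) * + M                     ≡⟨ cong (_* + M) (pos-*³ P' D g) ⟨
        + (P' ℕ.* (D ℕ.* g)) * + M                   ∎
    ; sq'≡pσ = begin
        + D * τ * + (P ℕ.* (Q₁ ℕ.* g))               ≡⟨ cong (+ D * τ *_) (pos-*³ P Q₁ g) ⟩
        + D * τ * (+ P * (+ Q₁ * + g))               ≡⟨ rearrange (+ P) (+ D) (+ Q₁) (+ g) τ ⟩
        + P * (+ D * + g) * (τ * + Q₁)               ≡⟨ cong (_* (τ * + Q₁)) (pos-*³ P D g) ⟨
        + (P ℕ.* (D ℕ.* g)) * (τ * + Q₁)             ∎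
    ; M̄ = proj₁ (inverse-modulo M⊥r)
    ; w = proj₁ (proj₂ (inverse-modulo M⊥r))
    ; MM̄≡1+wr = proj₂ (proj₂ (inverse-modulo M⊥r))
    }
    where open ≡-Reasoning

twist-from-cofactors : ∀ {r n p q p' q'} P P' d .{{_ : ℕ.NonZero r}} .{{_ : ℕ.NonZero n}}
                       .{{_ : ℕ.NonZero P'}} .{{_ : ℕ.NonZero d}} →
                       p ≡ P ℕ.* d → p' ≡ P' ℕ.* d → Coprime P P' → p ℕ.* q ≡ p' ℕ.* q' →
                       gcd p n ≡ gcd p' n → gcd q n ≡ gcd q' n → Twist r n p q p' q'
twist-from-cofactors {r} {n} {_} {q} {_} {q'} P P' d refl refl P⊥P' pq≡p'q' gcd-p gcd-q =
  twist-from-factors P P' D Q₁ g B n≡Bg (cong (P ℕ.*_) d≡Dg) (trans q≡P'Q (cong (P' ℕ.*_) Q≡Q₁g))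
    (cong (P' ℕ.*_) d≡Dg) (trans q'≡PQ (cong (P ℕ.*_) Q≡Q₁g)) P⊥B P'⊥B
  where
  Pq≡P'q' : P ℕ.* q ≡ P' ℕ.* q'
  Pq≡P'q' = ℕ.*-cancelʳ-≡ (P ℕ.* q) (P' ℕ.* q') d (begin
    P ℕ.* q ℕ.* d      ≡⟨ ℕ-Solver.solve (P ∷ q ∷ d ∷ []) ⟩
    P ℕ.* d ℕ.* q      ≡⟨ pq≡p'q' ⟩
    P' ℕ.* d ℕ.* q'    ≡⟨ ℕ-Solver.solve (P' ∷ d ∷ q' ∷ []) ⟩
    P' ℕ.* q' ℕ.* d    ∎)
    where open ≡-Reasoning
  Q : ℕ
  Q = proj₁ (coprime-proportion P⊥P' Pq≡P'q')
  q≡P'Q : q ≡ P' ℕ.* Q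
  q≡P'Q = proj₁ (proj₂ (coprime-proportion P⊥P' Pq≡P'q'))
  q'≡PQ : q' ≡ P ℕ.* Q
  q'≡PQ = proj₂ (proj₂ (coprime-proportion P⊥P' Pq≡P'q'))
  g : ℕ
  g = gcd d (gcd n Q)
  g∣d : g ∣ d
  g∣d = gcd[m,n]∣m d (gcd n Q)
  g∣n : g ∣ n
  g∣n = ℕ.∣-trans (gcd[m,n]∣n d _) (gcd[m,n]∣m n Q)
  g∣Q : g ∣ Q
  g∣Q = ℕ.∣-trans (gcd[m,n]∣n d _) (gcd[m,n]∣n n Q)
  D Q₁ B : ℕ
  D = quotient g∣d
  Q₁ = quotient g∣Q
  B = quotient g∣n
  d≡Dg : d ≡ D ℕ.* g
  d≡Dg = ℕ._∣_.equality g∣d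
  Q≡Q₁g : Q ≡ Q₁ ℕ.* g
  Q≡Q₁g = ℕ._∣_.equality g∣Q
  n≡Bg : n ≡ B ℕ.* g
  n≡Bg = ℕ._∣_.equality g∣n
  instance
    B≢0 : ℕ.NonZero B
    B≢0 = ℕ.quotient≢0 g∣n
  gcd-Q : gcd (P ℕ.* Q) n ≡ gcd (P' ℕ.* Q) n
  gcd-Q = trans (cong (λ x → gcd x n) (sym q'≡PQ)) (trans (sym gcd-q) (cong (λ x → gcd x n) q≡P'Q))
  P'⊥B : Coprime P' B
  P'⊥B = coprime-cofactor P⊥P' gcd-p gcd-Q n≡Bg
  P⊥B : Coprime P B
  P⊥B = coprime-cofactor (Coprime.sym P⊥P') (sym gcd-p) (sym gcd-Q) n≡Bg

twist-exists : ∀ {r n p q p' q'} .{{_ : ℕ.NonZero r}} .{{_ : ℕ.NonZero n}} .{{_ : ℕ.NonZero p}} .{{_ : ℕ.NonZero p'}} →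
               p ℕ.* q ≡ p' ℕ.* q' → gcd p n ≡ gcd p' n → gcd q n ≡ gcd q' n → Twist r n p q p' q'
twist-exists {p = p} {p' = p'} = twist-from-cofactors (quotient d∣p) (quotient d∣p') d
  (ℕ._∣_.equality d∣p) (ℕ._∣_.equality d∣p') P⊥P'
  where
  d : ℕ
  d = gcd p p'
  d∣p : d ∣ p
  d∣p = gcd[m,n]∣m p p'
  d∣p' : d ∣ p'
  d∣p' = gcd[m,n]∣n p p'
  instance
    d≢0 : ℕ.NonZero d
    d≢0 = ℕ.≢-nonZero (gcd[m,n]≢0 p p' (inj₁ (ℕ.≢-nonZero⁻¹ p)))
    P'≢0 : ℕ.NonZero (quotient d∣p')
    P'≢0 = ℕ.quotient≢0 d∣p'
  P⊥P' : Coprime (quotient d∣p) (quotient d∣p')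
  P⊥P' = Bézout-coprime (subst₂ (Bézout.Identity d) (ℕ._∣_.equality d∣p) (ℕ._∣_.equality d∣p')
                          (Bézout.identity (gcd-GCD p p')))

theorem3p3 : (r n p q p' q' : ℕ) → 0 < r → 0 < n →
             0 < p → 0 < q → 0 < p' → 0 < q' →
             (pr : p ∣ r) (qr : q ∣ r) (p'r : p' ∣ r) (q'r : q' ∣ r) →
             p ℕ.* q ≡ p' ℕ.* q' → (p ℕ.* q) ∣ (r ℕ.* n) →
             gcd p n ≡ gcd p' n → gcd q n ≡ gcd q' n →
             QuotIso r n p q p' q' qr q'r
theorem3p3 r n p q p' q' r>0 n>0 p>0 q>0 p'>0 q'>0 pr qr _ q'r pq≡p'q' _ gcd-p gcd-q =
  TwistIsomorphism.isomorphism qr q'r pr pq≡p'q' (twist-exists pq≡p'q' gcd-p gcd-q)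
  where
  instance
    r≢0 : ℕ.NonZero r
    r≢0 = ℕ.>-nonZero r>0
    n≢0 : ℕ.NonZero n
    n≢0 = ℕ.>-nonZero n>0
    p≢0 : ℕ.NonZero p
    p≢0 = ℕ.>-nonZero p>0
    q≢0 : ℕ.NonZero q
    q≢0 = ℕ.>-nonZero q>0
    p'≢0 : ℕ.NonZero p'
    p'≢0 = ℕ.>-nonZero p'>0
    q'≢0 : ℕ.NonZero q'
    q'≢0 = ℕ.>-nonZero q'>0
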